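{- Let $M$ be a multiagent Kripke structure with observations over agents $Ag=\{a_1,\dots,a_m\}$. For every history $h\cdot s$ of $M$, every record tuple $\vec r$ that stops at $h$, every observation $o$, every agent $a$ and every integer $k\ge0$, \[ T^k(h\cdot s,\vec r)=U_T^{k}(T^k(h,\vec r),s,\vec o(h,\vec r)) \quad\text{and}\quad T^k(h,\vec r\cdot(o,|h|-1)_a)=U_\Delta^{k}(T^k(h,\vec r),o,a).\]
   Context: A multiagent Kripke structure with observations is $M=(AP_f,S,T,V,\{\sim_o\}_{o\in\mathcal{O}},s_{\mathrm{init}},\vec o_{\mathrm{init}})$ with $AP_f$ a finite set of propositions, $S$ a set of states, $T\subseteq S\times S$ left-total, $V:S\to2^{AP_f}$, $\mathcal{O}$ a finite set of observations, each $\sim_o$ an equivalence relation on $S$, $s_{\mathrm{init}}\in S$, and $\vec o_{\mathrm{init}}$ a tuple assigning an initial observation to each agent of $Ag=\{a_1,\dots,a_m\}$. Paths and histories as usual; $|w|$, $\mathrm{last}(w)$, $w_i$ (from $0$). For tuples $\vec o$, $\vec o_a$ (or $\vec o_i$ for $a_i$) is the component of $a$. Observation records are finite words over $\mathcal{O}\times\mathbb{N}$; $r_{=n}$ is the subsequence of pairs with second component $n$. A record tuple $\vec r=\{r_a\}_{a\in Ag}$ has one record per agent; $\vec r\cdot(o,n)_a$ replaces $\vec r_a$ by $\vec r_a\cdot(o,n)$. $\vec r$ stops at $h$ if no component contains a pair $(o,m)$ with $m>|h|-1$. $\mathrm{ol}_a(\vec r,0)=(\vec o_{\mathrm{init}})_a\cdot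 o_1\cdots o_k$ if $(\vec r_a)_{=0}=(o_1,0)\cdots(o_k,0)$; $\mathrm{ol}_a(\vec r,n+1)=\mathrm{last}(\mathrm{ol}_a(\vec r,n))\cdot o_1\cdots o_k$ if $(\vec r_a)_{=n+1}=(o_1,n+1)\cdots(o_k,n+1)$. $\vec o(h,\vec r)$ is the tuple whose $a$-component is the last element of $\mathrm{ol}_a(\vec r,|h|-1)$. $h\sim^a_{\vec r}h'$ iff $|h|=|h'|$ and $h_i\sim_o h'_i$ for all $i<|h|$ and $o\in\mathrm{ol}_a(\vec r,i)$. $k$-trees: $T^0(h,\vec r)=\langle\mathrm{last}(h),\emptyset,\dots,\emptyset\rangle$ and $T^{k+1}(h,\vec r)=\langle\mathrm{last}(h),F_1,\dots,F_m\rangle$ with $F_i=\{T^k(h',\vec r)\mid h'\sim^{a_i}_{\vec r}h\}$. For a $k$-tree $\mathcal{T}=\langle s,F_1,\dots,F_m\rangle$, $\mathrm{root}(\mathcal{T})=s$ and $\mathcal{T}(a_i)=F_i$. Transition update: $U_T^0(\langle s,\emptyset,\dots,\emptyset\rangle,s',\vec o)=\langle s',\emptyset,\dots,\emptyset\rangle$; $U_T^{k+1}(\langle s,F_1,\dots,F_m\rangle,s',\vec o)=\langle s',F'_1,\dots,F'_m\rangle$ with $F'_i=\{U_T^k(\mathcal{T},s'',\vec o)\mid\mathcal{T}\in F_i,\ s''\sim_{\vec o_i}s',\ \mathrm{root}(\mathcal{T})\,T\,s''\}$. Observation-change update: $U_\Delta^0(\langle s,\emptyset,\dots,\emptyset\rangle,o',a_i)=\langle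 s,\emptyset,\dots,\emptyset\rangle$; $U_\Delta^{k+1}(\langle s,F_1,\dots,F_m\rangle,o',a_i)=\langle s,F'_1,\dots,F'_m\rangle$ with $F'_j=\{U_\Delta^k(\mathcal{T},o',a_i)\mid\mathcal{T}\in F_j\}$ for $j\ne i$ and $F'_i=\{U_\Delta^k(\mathcal{T},o',a_i)\mid\mathcal{T}\in F_i,\ \mathrm{root}(\mathcal{T})\sim_{o'}s\}$. -}

module Defs where

open import Level using (0ℓ)
open import Data.Nat using (ℕ; zero; suc; _≤_; _≟_)
open import Data.Fin using (Fin; toℕ)
import Data.Fin as Fin
open import Data.Bool using (Bool)
open import Data.Unit using (⊤)
open import Data.Product using (Σ; ∃; _×_; _,_; proj₁; proj₂)
open import Data.List using (List; []; _∷_; map; filter; _++_; [_])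
open import Data.List.NonEmpty using (List⁺; _∷_; last; toList)
open import Data.List.Membership.Propositional using (_∈_)
open import Data.Vec using (Vec; []; _∷_; head; lookup)
import Data.Vec as Vec
open import Relation.Binary.PropositionalEquality using (_≡_)
open import Relation.Binary.Structures using (IsEquivalence)
open import Relation.Nullary using (Dec; yes; no)

record MKS : Set₁ where
  field
    nAg nAP nObs : ℕ
    S        : Set
    Tr       : S → S → Set
    leftTotal : ∀ s → ∃ λ s' → Tr s s'
    V        : S → Fin nAP → Bool
    Sim      : Fin nObs → S → S → Set
    simEquiv : ∀ o → IsEquivalence (Sim o)
    sinit    : S
    oinit    : Fin nAg → Fin nObs

-- A "set" of elements of A, given as an indexed family (Aczel style);
-- set equality is extensional (see _≈T_ below).
record Fam (A : Set₁) : Set₁ where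
  constructor fam
  field
    Idx : Set
    elt : Idx → A
open Fam public

module _ (M : MKS) where
  open MKS M

  Agent = Fin nAg
  Obs   = Fin nObs

  Record      = List (Obs × ℕ)
  RecordTuple = Agent → Record

  restrictTo : Record → ℕ → Record
  restrictTo r n = filter (λ p → proj₂ p ≟ n) r

  extendRec : RecordTuple → Agent → Obs → ℕ → RecordTuple
  extendRec r a o n b with b Fin.≟ a
  ... | yes _ = r b ++ [ (o , n) ]
  ... | no  _ = r b

  ol : Agent → RecordTuple → ℕ → List⁺ Obs
  ol a r zero    = oinit a ∷ map proj₁ (restrictTo (r a) zero)
  ol a r (suc n) = last (ol a r n) ∷ map proj₁ (restrictTo (r a) (suc n))

  IsPath : ∀ {n} → Vec S n → Set
  IsPath []               = ⊤
  IsPath (x ∷ [])         = ⊤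
  IsPath (x ∷ y ∷ xs)     = Tr x y × IsPath (y ∷ xs)

  IsHistory : ∀ {n} → Vec S (suc n) → Set
  IsHistory h = (head h ≡ sinit) × IsPath h

  History : ℕ → Set
  History n = Σ (Vec S (suc n)) IsHistory

  -- ⃗r stops at h  (|h| = suc n, so |h| - 1 = n)
  StopsAt : ∀ {n} → RecordTuple → Vec S (suc n) → Set
  StopsAt {n} r h = ∀ a p → p ∈ r a → proj₂ p ≤ n

  obsTuple : ∀ {n} → Vec S (suc n) → RecordTuple → Agent → Obs
  obsTuple {n} h r a = last (ol a r n)

  IndistH : ∀ {n} → Agent → RecordTuple → Vec S (suc n) → Vec S (suc n) → Set
  IndistH {n} a r h h' =
    ∀ (i : Fin (suc n)) (o : Obs) → o ∈ toList (ol a r (toℕ i)) →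
      Sim o (lookup h i) (lookup h' i)

  -- k-trees.  A 0-tree ⟨s,∅,…,∅⟩ is represented by its root s;
  -- a (k+1)-tree ⟨s,F_1,…,F_m⟩ by s together with the sets F_i.
  KTree : ℕ → Set₁
  KTree zero    = Lift1 S
    where
      Lift1 : Set → Set₁
      Lift1 A = Level.Lift (Level.suc 0ℓ) A
  KTree (suc k) = Lift1 S × (Agent → Fam (KTree k))
    where
      Lift1 : Set → Set₁
      Lift1 A = Level.Lift (Level.suc 0ℓ) A

  root : ∀ {k} → KTree k → S
  root {zero}  t       = Level.lower t
  root {suc k} (s , _) = Level.lower s

  leaf : S → KTree zero
  leaf s = Level.lift s

  node : ∀ {k} → S → (Agent → Fam (KTree k)) → KTree (suc k)
  node s F = Level.lift s , F

  children : ∀ {k} → KTree (suc k) → Agent → Fam (KTree k)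
  children (_ , F) = F

  _≈T_ : ∀ {k} → KTree k → KTree k → Set
  _≈T_ {zero}  t t' = root t ≡ root t'
  _≈T_ {suc k} t t' =
    (root t ≡ root t') ×
    (∀ i → let F = children t i ; F' = children t' i in
       (∀ x → ∃ λ y → elt F x ≈T elt F' y) ×
       (∀ y → ∃ λ x → elt F x ≈T elt F' y))

  tree : (k : ℕ) → ∀ {n} → Vec S (suc n) → RecordTuple → KTree k
  tree zero    h r = leaf (Vec.last h)
  tree (suc k) {n} h r = node (Vec.last h) λ i →
    fam (Σ (History n) λ h' → IndistH i r (proj₁ h') h)
        (λ x → tree k (proj₁ (proj₁ x)) r)

  UT : (k : ℕ) → KTree k → S → (Agent → Obs) → KTree k
  UT zero    t s' o = leaf s'
  UT (suc k) t s' o = node s' λ i →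
    let F = children t i in
    fam (Σ (Idx F) λ j → Σ S λ s'' → Sim (o i) s'' s' × Tr (root (elt F j)) s'')
        (λ x → UT k (elt F (proj₁ x)) (proj₁ (proj₂ x)) o)

  UΔ : (k : ℕ) → KTree k → Obs → Agent → KTree k
  UΔ zero    t o' a = t
  UΔ (suc k) t o' a = node (root t) λ j → childΔ j (j Fin.≟ a)
    where
      childΔ : (j : Agent) → Dec (j ≡ a) → Fam (KTree k)
      childΔ j (no _)  = let F = children t j in
        fam (Idx F) (λ x → UΔ k (elt F x) o' a)
      childΔ j (yes _) = let F = children t j in
        fam (Σ (Idx F) λ x → Sim o' (root (elt F x)) (root t))
            (λ x → UΔ k (elt F (proj₁ x)) o' a)

module Submission where

-- Histories of length |h|+1 are exactly the h''·s'' with h''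
--     a history and last h'' T s''; and h''·s'' ∼^a_r h·s iff h'' ∼^a_r h and
--     s'' agrees with s on ol_a(r, |h|).  As r stops at h, that list is the
--     single observation o(h, r)_a, which gives the child sets of U_T.
--   * Observation change.  Appending (o, |h|-1) to r_a leaves the lists of
--     other agents unchanged and, for a, only appends o at time |h|-1; so ∼^a
--     gains exactly the constraint last h' ∼_o last h, the filter of U_Δ.

open import Defs
open import Data.Nat using (ℕ; suc)
open import Data.Fin using (Fin)
open import Data.Product using (_×_)
open import Data.Vec using (Vec; _∷ʳ_)

open import Data.Nat using (zero; _≤_; _<_; _≟_)
open import Data.Nat.Properties using (≤-refl; <⇒≢; n<1+n; ≤-<-trans; <-trans)
open import Data.Fin using (zero; suc; toℕ; fromℕ; inject₁)
import Data.Fin as Fin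
open import Data.Fin.Properties using (toℕ-inject₁; toℕ-fromℕ; toℕ<n)
open import Data.Fin.Relation.Unary.Top using (view; ‵fromℕ; ‵inj₁)
open import Data.Product using (∃; _,_; proj₁; proj₂; map₁)
open import Data.Sum using (_⊎_; inj₁; inj₂)
open import Data.List using ([]; _∷_; _++_; [_]; map)
open import Data.List.Properties using (filter-++; filter-accept; filter-reject; filter-none; map-++; ++-identityʳ)
open import Data.List.NonEmpty using (List⁺; _∷_; toList)
import Data.List.NonEmpty as List⁺
open import Data.List.Membership.Propositional using (_∈_)
open import Data.List.Membership.Propositional.Properties using (∈-++⁺ˡ; ∈-++⁺ʳ; ∈-++⁻)
open import Data.List.Relation.Unary.Any using (here)
import Data.List.Relation.Unary.All as All
open import Data.Vec using ([]; _∷_; lookup; initLast)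
import Data.Vec as Vec
open import Data.Vec.Properties using (last-∷ʳ)
open import Data.Empty using (⊥-elim)
open import Relation.Nullary using (yes; no)
open import Relation.Binary.PropositionalEquality
  using (_≡_; refl; sym; cong; cong₂; subst; subst₂; _≢_; module ≡-Reasoning)

lookup-∷ʳ-inject₁ : ∀ {A : Set} {n} (xs : Vec A n) y (j : Fin n) →
                    lookup (xs ∷ʳ y) (inject₁ j) ≡ lookup xs j
lookup-∷ʳ-inject₁ (x ∷ xs) y zero    = refl
lookup-∷ʳ-inject₁ (x ∷ xs) y (suc j) = lookup-∷ʳ-inject₁ xs y j

lookup-∷ʳ-fromℕ : ∀ {A : Set} {n} (xs : Vec A n) y → lookup (xs ∷ʳ y) (fromℕ n) ≡ y
lookup-∷ʳ-fromℕ []       y = refl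
lookup-∷ʳ-fromℕ (x ∷ xs) y = lookup-∷ʳ-fromℕ xs y

lookup-fromℕ : ∀ {A : Set} {n} (xs : Vec A (suc n)) → lookup xs (fromℕ n) ≡ Vec.last xs
lookup-fromℕ (x ∷ [])     = refl
lookup-fromℕ (x ∷ y ∷ xs) = lookup-fromℕ (y ∷ xs)

module Proposition24 (M : MKS) where
  open MKS M

  path-unsnoc : ∀ {n} (ys : Vec S (suc n)) y →
                IsPath M (ys ∷ʳ y) → IsPath M ys × Tr (Vec.last ys) y
  path-unsnoc (x ∷ [])     y (t , _) = _ , t
  path-unsnoc (x ∷ z ∷ zs) y (t , p) = map₁ (t ,_) (path-unsnoc (z ∷ zs) y p)

  path-snoc : ∀ {n} (ys : Vec S (suc n)) y →
              IsPath M ys → Tr (Vec.last ys) y → IsPath M (ys ∷ʳ y)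
  path-snoc (x ∷ [])     y _       t' = t' , _
  path-snoc (x ∷ z ∷ zs) y (t , p) t' = t , path-snoc (z ∷ zs) y p t'

  history-unsnoc : ∀ {n} (ys : Vec S (suc n)) y →
                   IsHistory M (ys ∷ʳ y) → IsHistory M ys × Tr (Vec.last ys) y
  history-unsnoc (x ∷ xs) y (init , p) = map₁ (init ,_) (path-unsnoc (x ∷ xs) y p)

  history-snoc : ∀ {n} (ys : Vec S (suc n)) y →
                 IsHistory M ys → Tr (Vec.last ys) y → IsHistory M (ys ∷ʳ y)
  history-snoc (x ∷ xs) y (init , p) t = init , path-snoc (x ∷ xs) y p t

  root-tree : ∀ k {n} (h : Vec S (suc n)) r → root M (tree M k h r) ≡ Vec.last h
  root-tree zero    h r = refl
  root-tree (suc k) h r = refl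

  Agree : List⁺ (Obs M) → S → S → Set
  Agree os x y = ∀ o → o ∈ toList os → Sim o x y

  agree-singleton : ∀ {o x y} → Sim o x y → Agree (o ∷ []) x y
  agree-singleton sim _ (here refl) = sim

  ol-local : ∀ a {r₁ r₂ : RecordTuple M} → r₁ a ≡ r₂ a → ∀ t → ol M a r₁ t ≡ ol M a r₂ t
  ol-local a e zero    = cong (λ ρ → oinit a ∷ map proj₁ (restrictTo M ρ zero)) e
  ol-local a e (suc t) =
    cong₂ (λ os ρ → List⁺.last os ∷ map proj₁ (restrictTo M ρ (suc t))) (ol-local a e t) e

  indist-local : ∀ a {r₁ r₂ : RecordTuple M} → r₁ a ≡ r₂ a →
                 ∀ {n} {h' h : Vec S (suc n)} → IndistH M a r₁ h' h → IndistH M a r₂ h' h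
  indist-local a e {h' = h'} {h} ind t =
    subst (λ os → Agree os (lookup h' t) (lookup h t)) (ol-local a e (toℕ t)) (ind t)

  ol-appended : ∀ {a} {r₁ r₂ : RecordTuple M} {o} m →
                (∀ t → t < m → ol M a r₁ t ≡ ol M a r₂ t) →
                map proj₁ (restrictTo M (r₁ a) m) ≡ map proj₁ (restrictTo M (r₂ a) m) ++ [ o ] →
                toList (ol M a r₁ m) ≡ toList (ol M a r₂ m) ++ [ o ]
  ol-appended {a} zero    _      recorded = cong (oinit a ∷_) recorded
  ol-appended     (suc m) before recorded = cong₂ _∷_ (cong List⁺.last (before m ≤-refl)) recorded

  restrict-beyond : ∀ {n} (ρ : Record M) → (∀ p → p ∈ ρ → proj₂ p ≤ n) →
                    restrictTo M ρ (suc n) ≡ []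
  restrict-beyond {n} ρ bounded = filter-none (λ p → proj₂ p ≟ suc n)
    (All.tabulate λ {p} p∈ρ late → <⇒≢ (≤-<-trans (bounded p p∈ρ) (n<1+n n)) late)

  ol-stopped : ∀ {n} (h : Vec S (suc n)) {r} → StopsAt M r h →
               ∀ a → ol M a r (suc n) ≡ obsTuple M h r a ∷ []
  ol-stopped {n} h {r} stops a =
    cong (λ ρ → List⁺.last (ol M a r n) ∷ map proj₁ ρ) (restrict-beyond (r a) (stops a))

  module _ {n} (h : Vec S (suc n)) {r} (stops : StopsAt M r h) (a : Agent M) {y s : S} where

    agree-stopped⇒ : Agree (ol M a r (suc n)) y s → Sim (obsTuple M h r a) y s
    agree-stopped⇒ agree = agree (obsTuple M h r a)
      (subst (λ os → obsTuple M h r a ∈ toList os) (sym (ol-stopped h stops a)) (here refl))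

    agree-stopped⇐ : Sim (obsTuple M h r a) y s → Agree (ol M a r (suc n)) y s
    agree-stopped⇐ sim = subst (λ os → Agree os y s) (sym (ol-stopped h stops a)) (agree-singleton sim)

  module _ (a : Agent M) (r : RecordTuple M) {n} (ys h : Vec S (suc n)) (y s : S) where

    indist-unsnoc : IndistH M a r (ys ∷ʳ y) (h ∷ʳ s) →
                    IndistH M a r ys h × Agree (ol M a r (suc n)) y s
    indist-unsnoc ind = earlier , latest
      where
        earlier : IndistH M a r ys h
        earlier t o o∈ =
          subst₂ (Sim o) (lookup-∷ʳ-inject₁ ys y t) (lookup-∷ʳ-inject₁ h s t)
            (ind (inject₁ t) o (subst (λ m → o ∈ toList (ol M a r m)) (sym (toℕ-inject₁ t)) o∈))
        latest : Agree (ol M a r (suc n)) y s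
        latest o o∈ =
          subst₂ (Sim o) (lookup-∷ʳ-fromℕ ys y) (lookup-∷ʳ-fromℕ h s)
            (ind (fromℕ (suc n)) o (subst (λ m → o ∈ toList (ol M a r m)) (sym (toℕ-fromℕ (suc n))) o∈))

    indist-snoc : IndistH M a r ys h → Agree (ol M a r (suc n)) y s →
                  IndistH M a r (ys ∷ʳ y) (h ∷ʳ s)
    indist-snoc ind agree t o o∈ with view t
    ... | ‵fromℕ =
      subst₂ (Sim o) (sym (lookup-∷ʳ-fromℕ ys y)) (sym (lookup-∷ʳ-fromℕ h s))
        (agree o (subst (λ m → o ∈ toList (ol M a r m)) (toℕ-fromℕ (suc n)) o∈))
    ... | ‵inj₁ {i = j} _ =
      subst₂ (Sim o) (sym (lookup-∷ʳ-inject₁ ys y j)) (sym (lookup-∷ʳ-inject₁ h s j))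
        (ind j o (subst (λ m → o ∈ toList (ol M a r m)) (toℕ-inject₁ j) o∈))

  module Extension (r : RecordTuple M) (a : Agent M) (o : Obs M) (n : ℕ) where

    r′ : RecordTuple M
    r′ = extendRec M r a o n

    extend-other : ∀ b → b ≢ a → r′ b ≡ r b
    extend-other b b≢a with b Fin.≟ a
    ... | yes b≡a = ⊥-elim (b≢a b≡a)
    ... | no  _   = refl

    extend-self : r′ a ≡ r a ++ [ (o , n) ]
    extend-self with a Fin.≟ a
    ... | yes _   = refl
    ... | no  a≢a = ⊥-elim (a≢a refl)

    restrict-other : ∀ m → m ≢ n → restrictTo M (r′ a) m ≡ restrictTo M (r a) m
    restrict-other m m≢n rewrite extend-self
      | filter-++ (λ p → proj₂ p ≟ m) (r a) [ (o , n) ]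
      | filter-reject (λ p → proj₂ p ≟ m) {x = (o , n)} {xs = []} (λ n≡m → m≢n (sym n≡m))
      = ++-identityʳ _

    restrict-self : restrictTo M (r′ a) n ≡ restrictTo M (r a) n ++ [ (o , n) ]
    restrict-self rewrite extend-self
      | filter-++ (λ p → proj₂ p ≟ n) (r a) [ (o , n) ]
      | filter-accept (λ p → proj₂ p ≟ n) {x = (o , n)} {xs = []} refl
      = refl

    ol-before : ∀ t → t < n → ol M a r′ t ≡ ol M a r t
    ol-before zero    t<n = cong (λ ρ → oinit a ∷ map proj₁ ρ) (restrict-other zero (<⇒≢ t<n))
    ol-before (suc t) t<n = cong₂ (λ os ρ → List⁺.last os ∷ map proj₁ ρ)
      (ol-before t (<-trans (n<1+n t) t<n)) (restrict-other (suc t) (<⇒≢ t<n))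

    recorded-at : map proj₁ (restrictTo M (r′ a) n) ≡ map proj₁ (restrictTo M (r a) n) ++ [ o ]
    recorded-at = begin
      map proj₁ (restrictTo M (r′ a) n)                  ≡⟨ cong (map proj₁) restrict-self ⟩
      map proj₁ (restrictTo M (r a) n ++ [ (o , n) ])    ≡⟨ map-++ proj₁ (restrictTo M (r a) n) _ ⟩
      map proj₁ (restrictTo M (r a) n) ++ [ o ]          ∎
      where open ≡-Reasoning

    ol-at : toList (ol M a r′ n) ≡ toList (ol M a r n) ++ [ o ]
    ol-at = ol-appended n ol-before recorded-at

    ol-⊇ : ∀ (t : Fin (suc n)) {o′} → o′ ∈ toList (ol M a r (toℕ t)) → o′ ∈ toList (ol M a r′ (toℕ t))
    ol-⊇ t {o′} o′∈ with view t
    ... | ‵fromℕ rewrite toℕ-fromℕ n | ol-at = ∈-++⁺ˡ o′∈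
    ... | ‵inj₁ {i = j} _ rewrite toℕ-inject₁ j =
      subst (λ os → o′ ∈ toList os) (sym (ol-before (toℕ j) (toℕ<n j))) o′∈

    ol-⊆ : ∀ (t : Fin (suc n)) {o′} → o′ ∈ toList (ol M a r′ (toℕ t)) →
           o′ ∈ toList (ol M a r (toℕ t)) ⊎ (t ≡ fromℕ n × o′ ≡ o)
    ol-⊆ t {o′} o′∈ with view t
    ... | ‵inj₁ {i = j} _ rewrite toℕ-inject₁ j =
      inj₁ (subst (λ os → o′ ∈ toList os) (ol-before (toℕ j) (toℕ<n j)) o′∈)
    ... | ‵fromℕ rewrite toℕ-fromℕ n | ol-at with ∈-++⁻ (toList (ol M a r n)) o′∈
    ...   | inj₁ old        = inj₁ old
    ...   | inj₂ (here refl) = inj₂ (refl , refl)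

    o-recorded : o ∈ toList (ol M a r′ (toℕ (fromℕ n)))
    o-recorded rewrite toℕ-fromℕ n | ol-at = ∈-++⁺ʳ (toList (ol M a r n)) (here refl)

    indist-extended : ∀ (h' h : Vec S (suc n)) →
                      IndistH M a r′ h' h → IndistH M a r h' h × Sim o (Vec.last h') (Vec.last h)
    indist-extended h' h ind =
        (λ t o′ o′∈ → ind t o′ (ol-⊇ t o′∈))
      , subst₂ (Sim o) (lookup-fromℕ h') (lookup-fromℕ h) (ind (fromℕ n) o o-recorded)

    indist-extend : ∀ (h' h : Vec S (suc n)) →
                    IndistH M a r h' h → Sim o (Vec.last h') (Vec.last h) → IndistH M a r′ h' h
    indist-extend h' h ind sim t o′ o′∈ with ol-⊆ t o′∈
    ... | inj₁ old           = ind t o′ old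
    ... | inj₂ (refl , refl) = subst₂ (Sim o) (sym (lookup-fromℕ h')) (sym (lookup-fromℕ h)) sim

  ForthMatch BackMatch SameSet : ∀ {k} → Fam (KTree M k) → Fam (KTree M k) → Set
  ForthMatch F F' = ∀ x → ∃ λ y → _≈T_ M (elt F x) (elt F' y)
  BackMatch  F F' = ∀ y → ∃ λ x → _≈T_ M (elt F x) (elt F' y)
  SameSet    F F' = ForthMatch F F' × BackMatch F F'

  tree-transition : ∀ k {n} (h : Vec S (suc n)) s r → StopsAt M r h →
                    _≈T_ M (tree M k (h ∷ʳ s) r) (UT M k (tree M k h r) s (obsTuple M h r))
  tree-transition zero    h s r stops = last-∷ʳ s h
  tree-transition (suc k) h s r stops = last-∷ʳ s h , λ a → truncate a , extend a
    where
      T⁺ U : KTree M (suc k)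
      T⁺ = tree M (suc k) (h ∷ʳ s) r
      U  = UT M (suc k) (tree M (suc k) h r) s (obsTuple M h r)

      truncate : ∀ a → ForthMatch (children M T⁺ a) (children M U a)
      truncate a ((h' , hist) , ind) with initLast h'
      ... | ys , y , refl =
        let (earlier , latest) = indist-unsnoc a r ys h y s ind
            (hist-ys , step)   = history-unsnoc ys y hist
        in  ( ((ys , hist-ys) , earlier) , y , agree-stopped⇒ h stops a latest
            , subst (λ z → Tr z y) (sym (root-tree k ys r)) step )
          , tree-transition k ys y r stops

      extend : ∀ a → BackMatch (children M T⁺ a) (children M U a)
      extend a (((h'' , hist) , ind) , s'' , sim , step) =
          ( (h'' ∷ʳ s'' , history-snoc h'' s'' hist (subst (λ z → Tr z s'') (root-tree k h'' r) step))
          , indist-snoc a r h'' h s'' s ind (agree-stopped⇐ h stops a sim) )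
        , tree-transition k h'' s'' r stops

  tree-observation : ∀ k {n} (h : Vec S (suc n)) r o a →
                     _≈T_ M (tree M k h (extendRec M r a o n)) (UΔ M k (tree M k h r) o a)
  tree-observation zero    h r o a = refl
  tree-observation (suc k) {n} h r o a = refl , matching
    where
      open Extension r a o n

      -- The U_Δ filter compares the root of a child tree, i.e. its last state.
      lower-root : ∀ {h'} → Sim o (root M (tree M k h' r)) (Vec.last h) → Sim o (Vec.last h') (Vec.last h)
      lower-root {h'} = subst (λ z → Sim o z (Vec.last h)) (root-tree k h' r)

      raise-root : ∀ {h'} → Sim o (Vec.last h') (Vec.last h) → Sim o (root M (tree M k h' r)) (Vec.last h)
      raise-root {h'} = subst (λ z → Sim o z (Vec.last h)) (sym (root-tree k h' r))

      matching : ∀ b → SameSet (children M (tree M (suc k) h r′) b)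
                               (children M (UΔ M (suc k) (tree M (suc k) h r) o a) b)
      matching b with b Fin.≟ a
      ... | no b≢a =
          (λ { ((h' , hist) , ind) → ((h' , hist) , indist-local b (extend-other b b≢a) {h' = h'} {h} ind)
                                    , tree-observation k h' r o a })
        , (λ { ((h' , hist) , ind) → ((h' , hist) , indist-local b (sym (extend-other b b≢a)) {h' = h'} {h} ind)
                                    , tree-observation k h' r o a })
      ... | yes refl =
          (λ { ((h' , hist) , ind) →
                 let (ind-r , sim) = indist-extended h' h ind
                 in  (((h' , hist) , ind-r) , raise-root sim)
                   , tree-observation k h' r o a })
        , (λ { (((h' , hist) , ind) , sim) →
                 ((h' , hist) , indist-extend h' h ind (lower-root sim))
               , tree-observation k h' r o a })

proposition24 : (M : MKS) → ∀ {n} (h : Vec (MKS.S M) (suc n)) (s : MKS.S M)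
                (r : RecordTuple M) (o : Fin (MKS.nObs M)) (a : Fin (MKS.nAg M)) (k : ℕ) →
                IsHistory M (h ∷ʳ s) → StopsAt M r h →
                _≈T_ M (tree M k (h ∷ʳ s) r) (UT M k (tree M k h r) s (obsTuple M h r))
                × _≈T_ M (tree M k h (extendRec M r a o n)) (UΔ M k (tree M k h r) o a)
proposition24 M h s r o a k _ stops =
  tree-transition k h s r stops , tree-observation k h r o a
  where open Proposition24 M
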